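{- Let $G=(V,E)$ be a finite simple undirected graph with $n$ vertices, and let $k\ge1$, $t\ge 0$ be integers with $k+t<n$; let $u\in V$. For each $v\in V\setminus(\{u\}\cup N(u))$ let $S_v$ be the unique minimum-size important $(u,v)$-separator, let $V_0$ be the set of those such $v$ with $|S_v|\le t$, and for $v\in V_0$ let $R(v)=R(v,S_v)$. Let $\mathcal{X}$ be the family of those sets $R(v)$, $v\in V_0$, for which there is no $w\in V_0$ with $R(w)\subsetneq R(v)$. Let $X\subseteq V$ be an inclusion-minimal set among the sets $Y\subseteq V$ with $u\in Y$, $|Y|\le k$ and $|N(Y)|\le t$, and let $Z$ be the union of all $A\in\mathcal{X}$ with $A\cap(X\cup N(X))=\emptyset$. Then $Z\neq\emptyset$ and there is an important $(Z,u)$-separator $S$ with $|S|\le t$ and $|R(u,S)|+|S|\le k+t$.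
   Context: $N(U)=\bigcup_{x\in U}N(x)\setminus U$ for $U\subseteq V$. For disjoint $X,Y\subseteq V$, a set $S\subseteq V\setminus(X\cup Y)$ is an $(X,Y)$-separator if $G-S$ has no path from $X$ to $Y$; it is minimal if no proper subset is an $(X,Y)$-separator. For $S$ and $X\subseteq V\setminus S$, $R(X,S)$ is the set of vertices reachable from $X$ in $G-S$. An $(X,Y)$-separator $T$ dominates an $(X,Y)$-separator $S$ if $|T|\le|S|$ and $R(X,S)\subsetneq R(X,T)$; $S$ is important if it is minimal and no $(X,Y)$-separator dominates it. Singletons $\{x\}$ are written $x$. It is known that if an $(X,Y)$-separator exists, there is exactly one important $(X,Y)$-separator of minimum size. -}

module Defs where

open import Data.Nat using (ℕ; zero; suc; _≤_)
open import Data.Bool using (Bool; true; false; not; _∧_; _∨_)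
open import Data.Fin using (Fin; zero; suc)
open import Data.Fin.Subset using (Subset; _∈_; _∉_; _⊂_; _⊆_; ∣_∣; _∪_)
open import Data.Vec using (tabulate; lookup)
open import Data.Product using (Σ; ∃; _×_; _,_)
open import Relation.Nullary using (¬_)
open import Relation.Binary.PropositionalEquality using (_≡_; _≢_)

record Graph (n : ℕ) : Set where
  field
    adj    : Fin n → Fin n → Bool
    sym    : ∀ x y → adj x y ≡ adj y x
    irrefl : ∀ x → adj x x ≡ false
open Graph public

anyFin : ∀ {m} → (Fin m → Bool) → Bool
anyFin {zero}  f = false
anyFin {suc m} f = f zero ∨ anyFin (λ i → f (suc i))

module _ {n : ℕ} (G : Graph n) where

  Nb : Subset n → Subset n
  Nb U = tabulate λ x → not (lookup U x) ∧ anyFin (λ y → lookup U y ∧ adj G y x)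

  -- There is a path in G - S from some vertex of X to y (i.e. y ∈ R(X,S)).
  data Reach (S : Subset n) (X : Fin n → Set) : Fin n → Set where
    base : ∀ {x} → X x → x ∉ S → Reach S X x
    step : ∀ {z y} → Reach S X z → adj G z y ≡ true → y ∉ S → Reach S X y

  IsSep : (X Y : Fin n → Set) → Subset n → Set
  IsSep X Y S = (∀ x → x ∈ S → ¬ X x × ¬ Y x) × (∀ y → Y y → ¬ Reach S X y)

  IsMinimalSep : (X Y : Fin n → Set) → Subset n → Set
  IsMinimalSep X Y S = IsSep X Y S × (∀ S′ → S′ ⊂ S → ¬ IsSep X Y S′)

  Dominates : (X : Fin n → Set) → (T S : Subset n) → Set
  Dominates X T S = ∣ T ∣ ≤ ∣ S ∣
    × (∀ x → Reach S X x → Reach T X x)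
    × ∃ (λ x → Reach T X x × ¬ Reach S X x)

  IsImportantSep : (X Y : Fin n → Set) → Subset n → Set
  IsImportantSep X Y S = IsMinimalSep X Y S
    × (∀ T → IsSep X Y T → ¬ Dominates X T S)

  IsMinImportantSep : (X Y : Fin n → Set) → Subset n → Set
  IsMinImportantSep X Y S = IsImportantSep X Y S
    × (∀ T → IsImportantSep X Y T → ∣ S ∣ ≤ ∣ T ∣)

  ⟪_⟫ : Fin n → Fin n → Set
  ⟪ v ⟫ x = x ≡ v

  NonNbr : Fin n → Fin n → Set
  NonNbr u v = v ≢ u × adj G u v ≡ false

  module Setup (t : ℕ) (u : Fin n) (Sv : Fin n → Subset n) where
    V₀ : Fin n → Set
    V₀ v = NonNbr u v × ∣ Sv v ∣ ≤ t

    Rv : Fin n → Fin n → Set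
    Rv v = Reach (Sv v) ⟪ v ⟫

    InFamily : Fin n → Set
    InFamily v = V₀ v × ¬ ∃ (λ w → V₀ w × (∀ x → Rv w x → Rv v x)
                                      × ∃ (λ x → Rv v x × ¬ Rv w x))

    Zset : Subset n → Fin n → Set
    Zset X z = ∃ λ v → InFamily v × (∀ y → Rv v y → y ∉ X ∪ Nb X) × Rv v z

  Admissible : ℕ → ℕ → Fin n → Subset n → Set
  Admissible k t u Y = u ∈ Y × ∣ Y ∣ ≤ k × ∣ Nb Y ∣ ≤ t

-- Write N[X] = X ∪ N(X). For v ∉ N[X] put A = R(u, S_v). Then N(A) ⊆ S_v, and N(A ∪ X) is
-- another (u,v)-separator, so |N(A)| ≤ |S_v| ≤ |N(A ∪ X)|; submodularity of |N(·)| gives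
-- |N(A ∩ X)| ≤ |N(X)| ≤ t, so A ∩ X is admissible and minimality of X forces X ⊆ A. Hence
-- R(v) avoids N[X]. Since N(X) separates u from v, such v lie in V₀, and descending along ⊊
-- among the sets R(w) gives a member of 𝒳 inside R(v), which therefore lies in Z and contains
-- its own centre. As |N[X]| ≤ k + t < n some v ∉ N[X] exists, so Z ≠ ∅, and every vertex
-- outside N[X] is reachable from Z in G − N(X). Improving the (Z,u)-separator N(X) to an
-- important one S keeps those vertices reachable from Z, so R(u,S) and S are disjoint subsets
-- of N[X] and |R(u,S)| + |S| ≤ |X| + |N(X)| ≤ k + t.
module Submission where

open import Defs hiding (sym)
open import Data.Nat using (ℕ; suc; _≤_; _<_; _+_; _∸_; _≤?_)
open import Data.Nat.Properties
  using (≤-refl; ≤-trans; +-suc; +-comm; m≤n+m; +-mono-≤; +-monoˡ-≤; +-cancelʳ-≤; +-mono-≤-<; +-mono-<-≤;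
         ∸-monoʳ-≤; ∸-monoʳ-<; <-≤-trans; <-irrefl; module ≤-Reasoning)
open import Data.Nat.Induction using (<-wellFounded)
open import Data.Bool using (Bool; true; false; not; _∧_)
import Data.Bool.Properties as Bool
open import Data.Fin using (Fin; zero; suc; _≟_)
open import Data.Fin.Properties using (any?; all?)
open import Data.Fin.Subset
  using (Subset; _∈_; _∉_; _⊂_; _⊆_; ∣_∣; _∪_; _∩_; ⁅_⁆; ⊤; ⊥; inside; outside)
open import Data.Fin.Subset.Properties
  using (_∈?_; _⊂?_; anySubset?; x∈p∪q⁻; x∈p∪q⁺; x∈p∩q⁻; x∈p∩q⁺; p∩q⊆q; p⊆p∪q; q⊆p∪q;
         x∈⁅x⁆; x∈⁅y⁆⇒x≡y; ∉⊥; ∣⊥∣≡0; ∣⊤∣≡n; ∣p∣≤n; ∣p∩q∣≤∣q∣; p⊆q⇒∣p∣≤∣q∣; p⊂q⇒∣p∣<∣q∣)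
open import Data.Vec using (_∷_; []; lookup)
open import Data.Vec.Properties using ([]=⇒lookup; lookup⇒[]=; lookup∘tabulate)
open import Data.Product using (Σ; ∃; _×_; _,_; proj₁; proj₂)
open import Data.Sum using (_⊎_; inj₁; inj₂; [_,_])
open import Data.Empty using (⊥-elim)
open import Function.Base using (_on_)
open import Function.Bundles using (_⇔_; mk⇔; module Equivalence)
open import Induction.WellFounded using (Acc; acc)
open import Relation.Binary.Construct.On using (wellFounded)
open import Relation.Nullary using (¬_; Dec; yes; no; contradiction)
open import Relation.Nullary.Decidable using (decidable-stable; ¬?; _×-dec_; _⊎-dec_; _→-dec_)
open import Relation.Unary using (Decidable)
open import Relation.Binary.PropositionalEquality using (_≡_; refl; sym; trans; cong; subst)

∣p∩q∣+∣p∪q∣≡∣p∣+∣q∣ : ∀ {n} (p q : Subset n) → ∣ p ∩ q ∣ + ∣ p ∪ q ∣ ≡ ∣ p ∣ + ∣ q ∣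
∣p∩q∣+∣p∪q∣≡∣p∣+∣q∣ []            []            = refl
∣p∩q∣+∣p∪q∣≡∣p∣+∣q∣ (outside ∷ p) (outside ∷ q) = ∣p∩q∣+∣p∪q∣≡∣p∣+∣q∣ p q
∣p∩q∣+∣p∪q∣≡∣p∣+∣q∣ (outside ∷ p) (inside  ∷ q) =
  trans (+-suc _ _) (trans (cong suc (∣p∩q∣+∣p∪q∣≡∣p∣+∣q∣ p q)) (sym (+-suc _ _)))
∣p∩q∣+∣p∪q∣≡∣p∣+∣q∣ (inside  ∷ p) (outside ∷ q) =
  trans (+-suc _ _) (cong suc (∣p∩q∣+∣p∪q∣≡∣p∣+∣q∣ p q))
∣p∩q∣+∣p∪q∣≡∣p∣+∣q∣ (inside  ∷ p) (inside  ∷ q) =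
  cong suc (trans (+-suc _ _) (trans (cong suc (∣p∩q∣+∣p∪q∣≡∣p∣+∣q∣ p q)) (sym (+-suc _ _))))

∣p∪q∣≤∣p∣+∣q∣ : ∀ {n} (p q : Subset n) → ∣ p ∪ q ∣ ≤ ∣ p ∣ + ∣ q ∣
∣p∪q∣≤∣p∣+∣q∣ p q = subst (∣ p ∪ q ∣ ≤_) (∣p∩q∣+∣p∪q∣≡∣p∣+∣q∣ p q) (m≤n+m _ _)

∣p∣+∣q∣≤∣r∣+∣s∣ : ∀ {n} {p q r s : Subset n} → p ∩ q ⊆ r ∩ s → p ∪ q ⊆ r ∪ s →
                  ∣ p ∣ + ∣ q ∣ ≤ ∣ r ∣ + ∣ s ∣
∣p∣+∣q∣≤∣r∣+∣s∣ {p = p} {q} {r} {s} ∩⊆∩ ∪⊆∪ = begin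
  ∣ p ∣ + ∣ q ∣             ≡⟨ sym (∣p∩q∣+∣p∪q∣≡∣p∣+∣q∣ p q) ⟩
  ∣ p ∩ q ∣ + ∣ p ∪ q ∣     ≤⟨ +-mono-≤ (p⊆q⇒∣p∣≤∣q∣ ∩⊆∩) (p⊆q⇒∣p∣≤∣q∣ ∪⊆∪) ⟩
  ∣ r ∩ s ∣ + ∣ r ∪ s ∣     ≡⟨ ∣p∩q∣+∣p∪q∣≡∣p∣+∣q∣ r s ⟩
  ∣ r ∣ + ∣ s ∣             ∎
  where open ≤-Reasoning

disjoint⇒∣p∣+∣q∣≤∣r∣ : ∀ {n} {p q r : Subset n} → (∀ {x} → x ∈ p → x ∉ q) → p ⊆ r → q ⊆ r →
                       ∣ p ∣ + ∣ q ∣ ≤ ∣ r ∣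
disjoint⇒∣p∣+∣q∣≤∣r∣ {n} {p} {q} {r} p∩q≡∅ p⊆r q⊆r =
  subst (∣ p ∣ + ∣ q ∣ ≤_) (cong (_+ ∣ r ∣) (∣⊥∣≡0 n)) (∣p∣+∣q∣≤∣r∣+∣s∣ p∩q⊆⊥∩r p∪q⊆⊥∪r)
  where
  p∩q⊆⊥∩r : p ∩ q ⊆ ⊥ ∩ r
  p∩q⊆⊥∩r x∈p∩q = let (x∈p , x∈q) = x∈p∩q⁻ p q x∈p∩q in contradiction x∈q (p∩q≡∅ x∈p)
  p∪q⊆⊥∪r : p ∪ q ⊆ ⊥ ∪ r
  p∪q⊆⊥∪r x∈p∪q = q⊆p∪q ⊥ r ([ p⊆r , q⊆r ] (x∈p∪q⁻ p q x∈p∪q))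

module _ {A : Set} (μ : A → ℕ) (_≺_ : A → A → Set)
         (≺-decreasing : ∀ {x y} → x ≺ y → μ x < μ y)
         (∃≺? : ∀ y → Dec (∃ λ x → x ≺ y)) where

  ∃-minimal : (P : A → Set) → (∀ {x y} → x ≺ y → P y → P x) →
              ∀ {y} → P y → ∃ λ x → P x × ¬ ∃ (λ z → z ≺ x)
  ∃-minimal P ≺-closed {y} Py = descend y (wellFounded μ <-wellFounded y) Py
    where
    descend : ∀ y → Acc (_<_ on μ) y → P y → ∃ λ x → P x × ¬ ∃ (λ z → z ≺ x)
    descend y (acc rec) Py with ∃≺? y
    ... | no  minimal      = y , Py , minimal
    ... | yes (x , x≺y)    = descend x (rec (≺-decreasing x≺y)) (≺-closed x≺y Py)

anyFin⁻ : ∀ {m} (f : Fin m → Bool) → anyFin f ≡ true → ∃ λ y → f y ≡ true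
anyFin⁻ {suc m} f e with f zero in f0
... | true  = zero , f0
... | false = let (y , fy) = anyFin⁻ (λ i → f (suc i)) e in suc y , fy

anyFin⁺ : ∀ {m} (f : Fin m → Bool) y → f y ≡ true → anyFin f ≡ true
anyFin⁺ f zero    fy rewrite fy = refl
anyFin⁺ f (suc y) fy with f zero
... | true  = refl
... | false = anyFin⁺ (λ i → f (suc i)) y fy

module _ {n : ℕ} (G : Graph n) where

  ⟪⟫? : (v : Fin n) → Decidable (⟪_⟫ G v)
  ⟪⟫? v x = x ≟ v

  adj-sym : ∀ {x y} → adj G x y ≡ true → adj G y x ≡ true
  adj-sym {x} {y} = trans (Graph.sym G y x)

  ∈Nb⁻ : ∀ {U x} → x ∈ Nb G U → x ∉ U × ∃ λ y → y ∈ U × adj G y x ≡ true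
  ∈Nb⁻ {U} {x} x∈N with lookup U x in Ux | trans (sym (lookup∘tabulate _ x)) ([]=⇒lookup x∈N)
  ... | false | any≡true with anyFin⁻ _ any≡true
  ...   | y , Uy∧adj with lookup U y in Uy | Uy∧adj
  ...     | true | adj≡true =
    (λ x∈U → contradiction (trans (sym ([]=⇒lookup x∈U)) Ux) λ ()) , y , lookup⇒[]= y U Uy , adj≡true

  ∈Nb⁺ : ∀ {U x y} → y ∈ U → adj G y x ≡ true → x ∉ U → x ∈ Nb G U
  ∈Nb⁺ {U} {x} {y} y∈U e x∉U = lookup⇒[]= x (Nb G U) (trans (lookup∘tabulate _ x) entry)
    where
    x-outside : lookup U x ≡ false
    x-outside with lookup U x in Ux
    ... | true  = contradiction (lookup⇒[]= x U Ux) x∉U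
    ... | false = refl
    entry : not (lookup U x) ∧ anyFin (λ z → lookup U z ∧ adj G z x) ≡ true
    entry rewrite x-outside =
      anyFin⁺ _ y (subst (λ b → b ∧ adj G y x ≡ true) (sym ([]=⇒lookup y∈U)) e)

  Nb-submodular : ∀ A B → ∣ Nb G (A ∩ B) ∣ + ∣ Nb G (A ∪ B) ∣ ≤ ∣ Nb G A ∣ + ∣ Nb G B ∣
  Nb-submodular A B = ∣p∣+∣q∣≤∣r∣+∣s∣ ∩⊆∩ ∪⊆∪
    where
    ∩⊆∩ : Nb G (A ∩ B) ∩ Nb G (A ∪ B) ⊆ Nb G A ∩ Nb G B
    ∩⊆∩ {i} i∈ with x∈p∩q⁻ (Nb G (A ∩ B)) _ i∈
    ... | i∈N∩ , i∈N∪ =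
      let (_ , y , y∈A∩B , e) = ∈Nb⁻ i∈N∩
          (i∉A∪B , _) = ∈Nb⁻ i∈N∪
          (y∈A , y∈B) = x∈p∩q⁻ A B y∈A∩B
      in x∈p∩q⁺ ( ∈Nb⁺ y∈A e (λ i∈A → i∉A∪B (x∈p∪q⁺ (inj₁ i∈A)))
                , ∈Nb⁺ y∈B e (λ i∈B → i∉A∪B (x∈p∪q⁺ (inj₂ i∈B))))
    N∩⊆ : ∀ {i} → i ∈ Nb G (A ∩ B) → i ∈ Nb G A ∪ Nb G B
    N∩⊆ {i} i∈ with ∈Nb⁻ i∈ | i ∈? A
    ... | i∉A∩B , y , y∈A∩B , e | yes i∈A =
      x∈p∪q⁺ (inj₂ (∈Nb⁺ (proj₂ (x∈p∩q⁻ A B y∈A∩B)) e (λ i∈B → i∉A∩B (x∈p∩q⁺ (i∈A , i∈B)))))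
    ... | _ , y , y∈A∩B , e | no i∉A =
      x∈p∪q⁺ (inj₁ (∈Nb⁺ (proj₁ (x∈p∩q⁻ A B y∈A∩B)) e i∉A))
    N∪⊆ : ∀ {i} → i ∈ Nb G (A ∪ B) → i ∈ Nb G A ∪ Nb G B
    N∪⊆ i∈ with ∈Nb⁻ i∈
    ... | i∉A∪B , y , y∈A∪B , e with x∈p∪q⁻ A B y∈A∪B
    ...   | inj₁ y∈A = x∈p∪q⁺ (inj₁ (∈Nb⁺ y∈A e (λ i∈A → i∉A∪B (x∈p∪q⁺ (inj₁ i∈A)))))
    ...   | inj₂ y∈B = x∈p∪q⁺ (inj₂ (∈Nb⁺ y∈B e (λ i∈B → i∉A∪B (x∈p∪q⁺ (inj₂ i∈B)))))
    ∪⊆∪ : Nb G (A ∩ B) ∪ Nb G (A ∪ B) ⊆ Nb G A ∪ Nb G B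
    ∪⊆∪ i∈ = [ N∩⊆ , N∪⊆ ] (x∈p∪q⁻ (Nb G (A ∩ B)) _ i∈)

  Reach-∉ : ∀ {S P x} → Reach G S P x → x ∉ S
  Reach-∉ (base _ x∉S)   = x∉S
  Reach-∉ (step _ _ x∉S) = x∉S

  Reach-mono : ∀ {S P P′ x} → (∀ {y} → P y → P′ y) → Reach G S P x → Reach G S P′ x
  Reach-mono P⊆P′ (base p y∉S)   = base (P⊆P′ p) y∉S
  Reach-mono P⊆P′ (step r e y∉S) = step (Reach-mono P⊆P′ r) e y∉S

  Reach-transfer : ∀ {S T P x} → (∀ {y} → Reach G S P y → y ∉ T) → Reach G S P x → Reach G T P x
  Reach-transfer avoids r@(base p _)   = base p (avoids r)
  Reach-transfer avoids r@(step r′ e _) = step (Reach-transfer avoids r′) e (avoids r)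

  Reach-antimono : ∀ {S T P x} → T ⊆ S → Reach G S P x → Reach G T P x
  Reach-antimono T⊆S = Reach-transfer (λ r y∈T → Reach-∉ r (T⊆S y∈T))

  Reach-trans : ∀ {S P y z} → Reach G S P y → Reach G S (⟪_⟫ G y) z → Reach G S P z
  Reach-trans r (base refl _)  = r
  Reach-trans r (step r′ e z∉S) = step (Reach-trans r r′) e z∉S

  Reach-sym : ∀ {S x y} → Reach G S (⟪_⟫ G x) y → Reach G S (⟪_⟫ G y) x
  Reach-sym (base refl x∉S) = base refl x∉S
  Reach-sym (step r e y∉S)  = Reach-trans (step (base refl y∉S) (adj-sym e) (Reach-∉ r)) (Reach-sym r)

  Reach-Nb-inside : ∀ {U P y} → (∀ {x} → P x → x ∈ U) → Reach G (Nb G U) P y → y ∈ U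
  Reach-Nb-inside P⊆U (base p _) = P⊆U p
  Reach-Nb-inside {U} {y = y} P⊆U (step r e y∉N) with y ∈? U
  ... | yes y∈U = y∈U
  ... | no  y∉U = contradiction (∈Nb⁺ (Reach-Nb-inside P⊆U r) e y∉U) y∉N

  Reach-Nb-outside : ∀ {U P y} → (∀ {x} → P x → x ∉ U) → Reach G (Nb G U) P y → y ∉ U
  Reach-Nb-outside P∩U≡∅ (base p _) = P∩U≡∅ p
  Reach-Nb-outside P∩U≡∅ (step r e _) y∈U =
    Reach-∉ r (∈Nb⁺ y∈U (adj-sym e) (Reach-Nb-outside P∩U≡∅ r))

  Nb-isSep : ∀ {U u v} → u ∈ U → v ∉ U → v ∉ Nb G U → IsSep G (⟪_⟫ G u) (⟪_⟫ G v) (Nb G U)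
  Nb-isSep u∈U v∉U v∉N =
      (λ x x∈N → (λ { refl → proj₁ (∈Nb⁻ x∈N) u∈U }) , (λ { refl → v∉N x∈N }))
    , λ { y refl r → v∉U (Reach-Nb-inside (λ { refl → u∈U }) r) }

  module _ (S : Subset n) (P : Fin n → Set) (P? : Decidable P) where

    private
      Extends : Subset n → Fin n → Set
      Extends W y = y ∉ W × y ∉ S × (P y ⊎ ∃ λ z → z ∈ W × adj G z y ≡ true)

      _⋖_ : Subset n → Subset n → Set
      W′ ⋖ W = ∃ λ y → Extends W y × W′ ≡ W ∪ ⁅ y ⁆

      ⋖-decreasing : ∀ {W′ W} → W′ ⋖ W → n ∸ ∣ W′ ∣ < n ∸ ∣ W ∣
      ⋖-decreasing {W = W} (y , (y∉W , _) , refl) =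
        ∸-monoʳ-< (p⊂q⇒∣p∣<∣q∣ W⊂W∪y) (∣p∣≤n (W ∪ ⁅ y ⁆))
        where
        W⊂W∪y : W ⊂ W ∪ ⁅ y ⁆
        W⊂W∪y = (λ {x} → p⊆p∪q ⁅ y ⁆) , y , q⊆p∪q W ⁅ y ⁆ (x∈⁅x⁆ y) , y∉W

      ∃⋖? : ∀ W → Dec (∃ λ W′ → W′ ⋖ W)
      ∃⋖? W with any? (λ y → ¬? (y ∈? W) ×-dec ¬? (y ∈? S) ×-dec
                         (P? y ⊎-dec any? (λ z → (z ∈? W) ×-dec (adj G z y Bool.≟ true))))
      ... | yes (y , ext) = yes (W ∪ ⁅ y ⁆ , y , ext , refl)
      ... | no  ¬ext      = no λ (_ , y , ext , _) → ¬ext (y , ext)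

      Sound : Subset n → Set
      Sound W = ∀ {x} → x ∈ W → Reach G S P x

      ⋖-sound : ∀ {W′ W} → W′ ⋖ W → Sound W → Sound W′
      ⋖-sound {W = W} (y , (_ , y∉S , why) , refl) sound x∈W′ with x∈p∪q⁻ W ⁅ y ⁆ x∈W′
      ... | inj₁ x∈W = sound x∈W
      ... | inj₂ x∈y with x∈⁅y⁆⇒x≡y y x∈y | why
      ...   | refl | inj₁ Py            = base Py y∉S
      ...   | refl | inj₂ (z , z∈W , e) = step (sound z∈W) e y∉S

      saturated⇒complete : ∀ {W} → ¬ ∃ (λ W′ → W′ ⋖ W) → ∀ {x} → Reach G S P x → x ∈ W
      saturated⇒complete {W} saturated {x} r with x ∈? W
      ... | yes x∈W = x∈W
      ... | no  x∉W = ⊥-elim (saturated (W ∪ ⁅ x ⁆ , x , (x∉W , Reach-∉ r , source r) , refl))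
        where
        source : ∀ {x} → Reach G S P x → P x ⊎ ∃ λ z → z ∈ W × adj G z x ≡ true
        source (base Px _)  = inj₁ Px
        source (step r′ e _) = inj₂ (_ , saturated⇒complete saturated r′ , e)

      reachable-spec : Σ (Subset n) λ W → ∀ x → x ∈ W ⇔ Reach G S P x
      reachable-spec with ∃-minimal (λ W → n ∸ ∣ W ∣) _⋖_ ⋖-decreasing ∃⋖? Sound ⋖-sound {⊥}
                                      (λ x∈⊥ → contradiction x∈⊥ ∉⊥)
      ... | W , sound , saturated = W , λ x → mk⇔ sound (saturated⇒complete saturated)

    reachable : Subset n
    reachable = proj₁ reachable-spec

    ∈reachable⁻ : ∀ {x} → x ∈ reachable → Reach G S P x
    ∈reachable⁻ {x} = Equivalence.to (proj₂ reachable-spec x)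

    ∈reachable⁺ : ∀ {x} → Reach G S P x → x ∈ reachable
    ∈reachable⁺ {x} = Equivalence.from (proj₂ reachable-spec x)

    Reach? : Decidable (Reach G S P)
    Reach? x with x ∈? reachable
    ... | yes x∈R = yes (∈reachable⁻ x∈R)
    ... | no  x∉R = no (λ r → x∉R (∈reachable⁺ r))

    Nb-reachable⊆ : Nb G reachable ⊆ S
    Nb-reachable⊆ {x} x∈N with x ∈? S | ∈Nb⁻ x∈N
    ... | yes x∈S | _                       = x∈S
    ... | no  x∉S | x∉R , y , y∈R , e = ⊥-elim (x∉R (∈reachable⁺ (step (∈reachable⁻ y∈R) e x∉S)))

  module _ {S T : Subset n} {P P′ : Fin n → Set} (P? : Decidable P) (P′? : Decidable P′)
           (S⇒T : ∀ {x} → Reach G S P x → Reach G T P′ x) where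

    private
      reachable⊆ : reachable S P P? ⊆ reachable T P′ P′?
      reachable⊆ x∈ = ∈reachable⁺ T P′ P′? (S⇒T (∈reachable⁻ S P P? x∈))

    ∣reachable∣-mono : ∣ reachable S P P? ∣ ≤ ∣ reachable T P′ P′? ∣
    ∣reachable∣-mono = p⊆q⇒∣p∣≤∣q∣ reachable⊆

    ∣reachable∣-strict : ∀ {x} → Reach G T P′ x → ¬ Reach G S P x →
                         ∣ reachable S P P? ∣ < ∣ reachable T P′ P′? ∣
    ∣reachable∣-strict {x} rT ¬rS = p⊂q⇒∣p∣<∣q∣
      (reachable⊆ , x , ∈reachable⁺ T P′ P′? rT , λ x∈ → ¬rS (∈reachable⁻ S P P? x∈))

  module _ {P Q : Fin n → Set} (P? : Decidable P) (Q? : Decidable Q) where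

    private
      isSep? : Decidable (IsSep G P Q)
      isSep? T = all? (λ x → (x ∈? T) →-dec (¬? (P? x) ×-dec ¬? (Q? x)))
          ×-dec all? (λ y → Q? y →-dec ¬? (Reach? T P P? y))

      dominates? : ∀ T S → Dec (Dominates G P T S)
      dominates? T S = (∣ T ∣ ≤? ∣ S ∣)
          ×-dec all? (λ x → Reach? S P P? x →-dec Reach? T P P? x)
          ×-dec any? (λ x → Reach? T P P? x ×-dec ¬? (Reach? S P P? x))

      -- S′ ≺ S: S′ witnesses that S is not minimal, or not important.
      _≺_ : Subset n → Subset n → Set
      S′ ≺ S = IsSep G P Q S′ × (S′ ⊂ S ⊎ Dominates G P S′ S)

      -- A dominating separator may be no smaller, but it enlarges the reachable set.
      μ : Subset n → ℕ
      μ S = (n ∸ ∣ reachable S P P? ∣) + ∣ S ∣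

      ≺-decreasing : ∀ {S′ S} → S′ ≺ S → μ S′ < μ S
      ≺-decreasing (_ , inj₁ S′⊂S) = +-mono-≤-<
        (∸-monoʳ-≤ n (∣reachable∣-mono P? P? (Reach-antimono (proj₁ S′⊂S)))) (p⊂q⇒∣p∣<∣q∣ S′⊂S)
      ≺-decreasing {S′} (_ , inj₂ (∣S′∣≤∣S∣ , S⇒S′ , _ , rS′ , ¬rS)) = +-mono-<-≤
        (∸-monoʳ-< (∣reachable∣-strict P? P? (λ {x} → S⇒S′ x) rS′ ¬rS) (∣p∣≤n (reachable S′ P P?)))
        ∣S′∣≤∣S∣

      ∃≺? : ∀ S → Dec (∃ λ S′ → S′ ≺ S)
      ∃≺? S = anySubset? (λ S′ → isSep? S′ ×-dec ((S′ ⊂? S) ⊎-dec dominates? S′ S))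

      Improves : Subset n → Subset n → Set
      Improves T S = IsSep G P Q S × ∣ S ∣ ≤ ∣ T ∣ × (∀ x → Reach G T P x → Reach G S P x)

      ≺-improves : ∀ {T S′ S} → S′ ≺ S → Improves T S → Improves T S′
      ≺-improves (sepS′ , inj₁ S′⊂S) (_ , ∣S∣≤∣T∣ , T⇒S) =
        sepS′ , ≤-trans (p⊆q⇒∣p∣≤∣q∣ (proj₁ S′⊂S)) ∣S∣≤∣T∣ ,
        λ x r → Reach-antimono (proj₁ S′⊂S) (T⇒S x r)
      ≺-improves (sepS′ , inj₂ (∣S′∣≤∣S∣ , S⇒S′ , _)) (_ , ∣S∣≤∣T∣ , T⇒S) =
        sepS′ , ≤-trans ∣S′∣≤∣S∣ ∣S∣≤∣T∣ , λ x r → S⇒S′ x (T⇒S x r)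

    importantSep-above : ∀ {T} → IsSep G P Q T →
      ∃ λ S → IsImportantSep G P Q S × ∣ S ∣ ≤ ∣ T ∣ × (∀ x → Reach G T P x → Reach G S P x)
    importantSep-above {T} sepT with ∃-minimal μ _≺_ ≺-decreasing ∃≺? (Improves T) ≺-improves
                                       (sepT , ≤-refl , λ _ r → r)
    ... | S , (sepS , ∣S∣≤∣T∣ , T⇒S) , ¬≺ =
      S , ( (sepS , λ S′ S′⊂S sepS′ → ¬≺ (S′ , sepS′ , inj₁ S′⊂S))
          , λ S′ sepS′ dom → ¬≺ (S′ , sepS′ , inj₂ dom)) , ∣S∣≤∣T∣ , T⇒S

    minImportantSep-≤ : ∀ {S T} → IsMinImportantSep G P Q S → IsSep G P Q T → ∣ S ∣ ≤ ∣ T ∣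
    minImportantSep-≤ (_ , minimum) sepT =
      let (S′ , impS′ , ∣S′∣≤∣T∣ , _) = importantSep-above sepT in ≤-trans (minimum S′ impS′) ∣S′∣≤∣T∣

module _ {n : ℕ} (G : Graph n) (k t : ℕ) (u : Fin n) (Sv : Fin n → Subset n)
         (Sv-minImportant : ∀ v → NonNbr G u v → IsMinImportantSep G (⟪_⟫ G u) (⟪_⟫ G v) (Sv v))
         (X : Subset n) (X-admissible : Admissible G k t u X)
         (X-minimal : ∀ Y → Admissible G k t u Y → ¬ (Y ⊂ X)) where

  open Setup G t u Sv

  private
    u∈X : u ∈ X
    u∈X = proj₁ X-admissible

    ∣X∣≤k : ∣ X ∣ ≤ k
    ∣X∣≤k = proj₁ (proj₂ X-admissible)

    ∣NX∣≤t : ∣ Nb G X ∣ ≤ t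
    ∣NX∣≤t = proj₂ (proj₂ X-admissible)

  N[X] : Subset n
  N[X] = X ∪ Nb G X

  private
    ∉N[X]⇒∉X : ∀ {v} → v ∉ N[X] → v ∉ X
    ∉N[X]⇒∉X v∉ v∈X = v∉ (x∈p∪q⁺ (inj₁ v∈X))

    ∉N[X]⇒∉NX : ∀ {v} → v ∉ N[X] → v ∉ Nb G X
    ∉N[X]⇒∉NX v∉ v∈NX = v∉ (x∈p∪q⁺ (inj₂ v∈NX))

  ∣N[X]∣≤k+t : ∣ N[X] ∣ ≤ k + t
  ∣N[X]∣≤k+t = ≤-trans (∣p∪q∣≤∣p∣+∣q∣ X (Nb G X)) (+-mono-≤ ∣X∣≤k ∣NX∣≤t)

  ∃∉N[X] : k + t < n → ∃ λ v → v ∉ N[X]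
  ∃∉N[X] k+t<n with any? (λ v → ¬? (v ∈? N[X]))
  ... | yes v∉ = v∉
  ... | no ¬∃  = contradiction (<-≤-trans k+t<n (≤-trans n≤∣N[X]∣ ∣N[X]∣≤k+t)) (<-irrefl refl)
    where
    n≤∣N[X]∣ : n ≤ ∣ N[X] ∣
    n≤∣N[X]∣ = subst (_≤ ∣ N[X] ∣) (∣⊤∣≡n n)
      (p⊆q⇒∣p∣≤∣q∣ {p = ⊤} (λ {v} _ → decidable-stable (v ∈? N[X]) (λ v∉ → ¬∃ (v , v∉))))

  ∉N[X]⇒NonNbr : ∀ {v} → v ∉ N[X] → NonNbr G u v
  ∉N[X]⇒NonNbr {v} v∉ = (λ { refl → ∉N[X]⇒∉X v∉ u∈X }) , u≁v
    where
    u≁v : adj G u v ≡ false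
    u≁v with adj G u v in u∼v
    ... | true  = contradiction (∈Nb⁺ G u∈X u∼v (∉N[X]⇒∉X v∉)) (∉N[X]⇒∉NX v∉)
    ... | false = refl

  Sv-isSep : ∀ {v} → NonNbr G u v → IsSep G (⟪_⟫ G u) (⟪_⟫ G v) (Sv v)
  Sv-isSep {v} u≁v = proj₁ (proj₁ (proj₁ (Sv-minImportant v u≁v)))

  ∉N[X]⇒V₀ : ∀ {v} → v ∉ N[X] → V₀ v
  ∉N[X]⇒V₀ {v} v∉ = u≁v , ≤-trans ∣Sv∣≤∣NX∣ ∣NX∣≤t
    where
    u≁v : NonNbr G u v
    u≁v = ∉N[X]⇒NonNbr v∉
    ∣Sv∣≤∣NX∣ : ∣ Sv v ∣ ≤ ∣ Nb G X ∣
    ∣Sv∣≤∣NX∣ = minImportantSep-≤ G (⟪⟫? G u) (⟪⟫? G v) (Sv-minImportant v u≁v)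
                  (Nb-isSep G u∈X (∉N[X]⇒∉X v∉) (∉N[X]⇒∉NX v∉))

  module _ {v} (v∉N[X] : v ∉ N[X]) where

    private
      u≁v : NonNbr G u v
      u≁v = ∉N[X]⇒NonNbr v∉N[X]

      sepV : IsSep G (⟪_⟫ G u) (⟪_⟫ G v) (Sv v)
      sepV = Sv-isSep u≁v

      A : Subset n
      A = reachable G (Sv v) (⟪_⟫ G u) (⟪⟫? G u)

      v∉Sv : v ∉ Sv v
      v∉Sv v∈Sv = proj₂ (proj₁ sepV v v∈Sv) refl

      v∉A : v ∉ A
      v∉A v∈A = proj₂ sepV v refl (∈reachable⁻ G _ _ _ v∈A)

      u∈A : u ∈ A
      u∈A = ∈reachable⁺ G _ _ _ (base refl λ u∈Sv → proj₁ (proj₁ sepV u u∈Sv) refl)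

      v∉A∪X : v ∉ A ∪ X
      v∉A∪X v∈A∪X = [ v∉A , ∉N[X]⇒∉X v∉N[X] ] (x∈p∪q⁻ A X v∈A∪X)

      v∉N[A∪X] : v ∉ Nb G (A ∪ X)
      v∉N[A∪X] v∈N with ∈Nb⁻ G v∈N
      ... | _ , y , y∈A∪X , y∼v with x∈p∪q⁻ A X y∈A∪X
      ...   | inj₁ y∈A = v∉A (∈reachable⁺ G _ _ _ (step (∈reachable⁻ G _ _ _ y∈A) y∼v v∉Sv))
      ...   | inj₂ y∈X = ∉N[X]⇒∉NX v∉N[X] (∈Nb⁺ G y∈X y∼v (∉N[X]⇒∉X v∉N[X]))

      ∣N[A∩X]∣≤∣NX∣ : ∣ Nb G (A ∩ X) ∣ ≤ ∣ Nb G X ∣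
      ∣N[A∩X]∣≤∣NX∣ = +-cancelʳ-≤ _ _ _ (begin
        ∣ Nb G (A ∩ X) ∣ + ∣ Nb G (A ∪ X) ∣ ≤⟨ Nb-submodular G A X ⟩
        ∣ Nb G A ∣ + ∣ Nb G X ∣             ≤⟨ +-monoˡ-≤ _ (≤-trans ∣NA∣≤∣Sv∣ ∣Sv∣≤∣N[A∪X]∣) ⟩
        ∣ Nb G (A ∪ X) ∣ + ∣ Nb G X ∣       ≡⟨ +-comm ∣ Nb G (A ∪ X) ∣ ∣ Nb G X ∣ ⟩
        ∣ Nb G X ∣ + ∣ Nb G (A ∪ X) ∣       ∎)
        where
        open ≤-Reasoning
        ∣NA∣≤∣Sv∣ : ∣ Nb G A ∣ ≤ ∣ Sv v ∣
        ∣NA∣≤∣Sv∣ = p⊆q⇒∣p∣≤∣q∣ (Nb-reachable⊆ G (Sv v) (⟪_⟫ G u) (⟪⟫? G u))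
        ∣Sv∣≤∣N[A∪X]∣ : ∣ Sv v ∣ ≤ ∣ Nb G (A ∪ X) ∣
        ∣Sv∣≤∣N[A∪X]∣ = minImportantSep-≤ G (⟪⟫? G u) (⟪⟫? G v) (Sv-minImportant v u≁v)
                          (Nb-isSep G (x∈p∪q⁺ (inj₂ u∈X)) v∉A∪X v∉N[A∪X])

    X⊆R[u,Sv] : X ⊆ reachable G (Sv v) (⟪_⟫ G u) (⟪⟫? G u)
    X⊆R[u,Sv] {x} x∈X = decidable-stable (x ∈? A) λ x∉A →
      X-minimal (A ∩ X) A∩X-admissible
        (p∩q⊆q A X , x , x∈X , λ x∈A∩X → x∉A (proj₁ (x∈p∩q⁻ A X x∈A∩X)))
      where
      A∩X-admissible : Admissible G k t u (A ∩ X)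
      A∩X-admissible =
        x∈p∩q⁺ (u∈A , u∈X) , ≤-trans (∣p∩q∣≤∣q∣ A X) ∣X∣≤k , ≤-trans ∣N[A∩X]∣≤∣NX∣ ∣NX∣≤t

    Rv-avoids-N[X] : ∀ {y} → Rv v y → y ∉ N[X]
    Rv-avoids-N[X] {y} r y∈N[X] =
      v∉A (∈reachable⁺ G _ _ _ (Reach-trans G (∈reachable⁻ G _ _ _ y∈A) (Reach-sym G r)))
      where
      y∈A : y ∈ A
      y∈A with x∈p∪q⁻ X (Nb G X) y∈N[X]
      ... | inj₁ y∈X = X⊆R[u,Sv] y∈X
      ... | inj₂ y∈NX with ∈Nb⁻ G y∈NX
      ...   | _ , x , x∈X , x∼y =
        ∈reachable⁺ G _ _ _ (step (∈reachable⁻ G _ _ _ (X⊆R[u,Sv] x∈X)) x∼y (Reach-∉ G r))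

  Rv? : ∀ v → Decidable (Rv v)
  Rv? v = Reach? G (Sv v) (⟪_⟫ G v) (⟪⟫? G v)

  -- InFamily v unfolds to V₀ v × ¬ ∃ (λ w → w ⊏ v).
  _⊏_ : Fin n → Fin n → Set
  w ⊏ v = V₀ w × (∀ x → Rv w x → Rv v x) × ∃ (λ x → Rv v x × ¬ Rv w x)

  private
    V₀? : Decidable V₀
    V₀? v = (¬? (v ≟ u) ×-dec (adj G u v Bool.≟ false)) ×-dec (∣ Sv v ∣ ≤? t)

    ⊏? : ∀ w v → Dec (w ⊏ v)
    ⊏? w v = V₀? w ×-dec all? (λ x → Rv? w x →-dec Rv? v x)
                   ×-dec any? (λ x → Rv? v x ×-dec ¬? (Rv? w x))

    InFamily? : Decidable InFamily
    InFamily? v = V₀? v ×-dec ¬? (any? (λ w → ⊏? w v))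

    ∣Rv∣ : Fin n → ℕ
    ∣Rv∣ w = ∣ reachable G (Sv w) (⟪_⟫ G w) (⟪⟫? G w) ∣

    ⊏-decreasing : ∀ {w v} → w ⊏ v → ∣Rv∣ w < ∣Rv∣ v
    ⊏-decreasing {w} {v} (_ , w⇒v , _ , rv , ¬rw) =
      ∣reachable∣-strict G (⟪⟫? G w) (⟪⟫? G v) (λ {x} → w⇒v x) rv ¬rw

  ∃-InFamily-⊆ : ∀ {v} → V₀ v → ∃ λ w → InFamily w × (∀ x → Rv w x → Rv v x)
  ∃-InFamily-⊆ {v} v∈V₀
    with ∃-minimal ∣Rv∣ _⊏_ ⊏-decreasing (λ v → any? (λ w → ⊏? w v))
                   (λ w → V₀ w × (∀ x → Rv w x → Rv v x))
                   (λ (w∈V₀ , w⇒v′ , _) (_ , v′⇒v) → w∈V₀ , λ x r → v′⇒v x (w⇒v′ x r))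
                   (v∈V₀ , λ _ r → r)
  ... | w , (w∈V₀ , w⇒v) , minimal = w , (w∈V₀ , minimal) , w⇒v

  ∉N[X]⇒Z-in-Rv : ∀ {v} → v ∉ N[X] → ∃ λ z → Zset X z × Rv v z
  ∉N[X]⇒Z-in-Rv v∉ with ∃-InFamily-⊆ (∉N[X]⇒V₀ v∉)
  ... | w , w∈𝒳 , w⇒v = w , (w , w∈𝒳 , (λ y r → Rv-avoids-N[X] v∉ (w⇒v y r)) , w∈Rw) , w⇒v w w∈Rw
    where
    w∈Rw : Rv w w
    w∈Rw = base refl λ w∈Sw → proj₂ (proj₁ (Sv-isSep (proj₁ (proj₁ w∈𝒳))) w w∈Sw) refl

  Zset-nonempty : k + t < n → ∃ (Zset X)
  Zset-nonempty k+t<n = let (v , v∉) = ∃∉N[X] k+t<n ; (z , z∈Z , _) = ∉N[X]⇒Z-in-Rv v∉ in z , z∈Z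

  Zset⇒∉N[X] : ∀ {z} → Zset X z → z ∉ N[X]
  Zset⇒∉N[X] (_ , _ , avoids , r) = avoids _ r

  Zset? : Decidable (Zset X)
  Zset? z = any? (λ v → InFamily? v ×-dec all? (λ y → Rv? v y →-dec ¬? (y ∈? N[X])) ×-dec Rv? v z)

  NX-isSep : IsSep G (Zset X) (⟪_⟫ G u) (Nb G X)
  NX-isSep =
      (λ x x∈N → (λ z → Zset⇒∉N[X] z (x∈p∪q⁺ (inj₂ x∈N))) , (λ { refl → proj₁ (∈Nb⁻ G x∈N) u∈X }))
    , λ { y refl r → Reach-Nb-outside G (λ z x∈X → Zset⇒∉N[X] z (x∈p∪q⁺ (inj₁ x∈X))) r u∈X }

  ∉N[X]⇒Reach-Zset : ∀ {y} → y ∉ N[X] → Reach G (Nb G X) (Zset X) y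
  ∉N[X]⇒Reach-Zset {y} y∉ with ∉N[X]⇒Z-in-Rv y∉
  ... | z , z∈Z , rz = Reach-mono G (λ { refl → z∈Z }) (Reach-sym G (Reach-transfer G avoids rz))
    where
    avoids : ∀ {x} → Rv y x → x ∉ Nb G X
    avoids r x∈NX = Rv-avoids-N[X] y∉ r (x∈p∪q⁺ (inj₂ x∈NX))

  importantSep-bounded : ∃ λ S → IsImportantSep G (Zset X) (⟪_⟫ G u) S × ∣ S ∣ ≤ t
    × ∃ (λ R → (∀ x → (x ∈ R) ⇔ Reach G S (⟪_⟫ G u) x) × ∣ R ∣ + ∣ S ∣ ≤ k + t)
  importantSep-bounded with importantSep-above G Zset? (⟪⟫? G u) NX-isSep
  ... | S , S-important , ∣S∣≤∣NX∣ , NX⇒S =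
    S , S-important , ≤-trans ∣S∣≤∣NX∣ ∣NX∣≤t ,
    R , (λ x → mk⇔ (∈reachable⁻ G _ _ _) (∈reachable⁺ G _ _ _)) ,
    ≤-trans (disjoint⇒∣p∣+∣q∣≤∣r∣ (λ x∈R → Reach-∉ G (∈reachable⁻ G _ _ _ x∈R)) R⊆N[X] S⊆N[X])
            ∣N[X]∣≤k+t
    where
    R : Subset n
    R = reachable G S (⟪_⟫ G u) (⟪⟫? G u)
    outside⇒Reach : ∀ {x} → x ∉ N[X] → Reach G S (Zset X) x
    outside⇒Reach x∉ = NX⇒S _ (∉N[X]⇒Reach-Zset x∉)
    S⊆N[X] : S ⊆ N[X]
    S⊆N[X] {x} x∈S = decidable-stable (x ∈? N[X]) λ x∉ → Reach-∉ G (outside⇒Reach x∉) x∈S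
    R⊆N[X] : R ⊆ N[X]
    R⊆N[X] {x} x∈R = decidable-stable (x ∈? N[X]) λ x∉ →
      proj₂ (proj₁ (proj₁ S-important)) u refl
        (Reach-trans G (outside⇒Reach x∉) (Reach-sym G (∈reachable⁻ G _ _ _ x∈R)))

lemma6 : (n : ℕ) (G : Graph n) (k t : ℕ) → 1 ≤ k → k + t < n → (u : Fin n)
    → (Sv : Fin n → Subset n)
    → (∀ v → NonNbr G u v → IsMinImportantSep G (⟪_⟫ G u) (⟪_⟫ G v) (Sv v))
    → (X : Subset n)
    → Admissible G k t u X
    → (∀ Y → Admissible G k t u Y → ¬ (Y ⊂ X))
    → ∃ (λ z → Setup.Zset G t u Sv X z)
      × ∃ (λ S → IsImportantSep G (Setup.Zset G t u Sv X) (⟪_⟫ G u) S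
          × ∣ S ∣ ≤ t
          × ∃ (λ R → (∀ x → (x ∈ R) ⇔ Reach G S (⟪_⟫ G u) x) × ∣ R ∣ + ∣ S ∣ ≤ k + t))
lemma6 n G k t _ k+t<n u Sv Sv-minImportant X X-admissible X-minimal =
  Zset-nonempty G k t u Sv Sv-minImportant X X-admissible X-minimal k+t<n ,
  importantSep-bounded G k t u Sv Sv-minImportant X X-admissible X-minimal
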